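{- Let $L,R$ be nonempty subsets of a group $G$ such that $\mathcal{W}(L)$ and $\mathcal{W}(R)$ are subgroups of $G$. The two-sided group digraph $2\mathrm{S}(G;L,R)$ is strongly connected if and only if $G=\langle L\rangle\langle R\rangle$ and $e=w_{L^{ -1},i}\,w_{R,j}$ for some word $w_{L^{ -1},i}$ in $L^{ -1}$ of length $i$ and some word $w_{R,j}$ in $R$ of length $j$ with $|i-j|=1$.
   Context: For a group $G$ with identity $e$ and nonempty subsets $L,R\subseteq G$, the two-sided group digraph $2\mathrm{S}(G;L,R)$ has vertex set $G$ and a directed arc $(g,h)$ if and only if $h=l^{ -1}gr$ for some $l\in L$, $r\in R$. A digraph is strongly connected if for all vertices $g,h$ there is a directed path from $g$ to $h$. A word in a set $S$ of length $n$ is a product $s_1\cdots s_n$ with all $s_i\in S$; $\mathcal{W}(S)$ is the set of elements given by words in $S$ of finite positive length; $L^{ -1}=\{l^{ -1}:l\in L\}$; $\langle X\rangle$ is the subgroup generated by $X$ and $AB=\{ab:a\in A,b\in B\}$. -}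

module Defs where

open import Level using (Level; _⊔_)
open import Algebra.Bundles using (Group)
open import Data.Nat using (ℕ; zero; suc)
open import Data.Product using (Σ; ∃; ∃-syntax; _×_; _,_)
open import Data.Sum using (_⊎_)
open import Relation.Binary.PropositionalEquality using (_≡_)
open import Relation.Unary using (Pred)

module _ {c ℓ : Level} (G : Group c ℓ) where
  open Group G

  InvSet : ∀ {p} → Pred Carrier p → Pred Carrier (c ⊔ ℓ ⊔ p)
  InvSet L x = Σ Carrier λ l → L l × x ≈ l ⁻¹

  data Word {p} (S : Pred Carrier p) : ℕ → Carrier → Set (c ⊔ ℓ ⊔ p) where
    one  : ∀ {s x} → S s → x ≈ s → Word S 1 x
    snoc : ∀ {n y s x} → Word S n y → S s → x ≈ y ∙ s → Word S (suc n) x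

  𝒲 : ∀ {p} → Pred Carrier p → Pred Carrier (c ⊔ ℓ ⊔ p)
  𝒲 S x = ∃[ n ] Word S n x

  IsSubgroup : ∀ {q} → Pred Carrier q → Set (c ⊔ ℓ ⊔ q)
  IsSubgroup P =
    P ε
    × (∀ {x y} → P x → P y → P (x ∙ y))
    × (∀ {x} → P x → P (x ⁻¹))
    × (∀ {x y} → x ≈ y → P x → P y)

  data Gen {p} (X : Pred Carrier p) : Carrier → Set (c ⊔ ℓ ⊔ p) where
    gen  : ∀ {x} → X x → Gen X x
    unit : Gen X ε
    mul  : ∀ {x y} → Gen X x → Gen X y → Gen X (x ∙ y)
    inv  : ∀ {x} → Gen X x → Gen X (x ⁻¹)
    resp : ∀ {x y} → x ≈ y → Gen X x → Gen X y

  GroupIsProduct : ∀ {q} → Pred Carrier q → Pred Carrier q → Set (c ⊔ ℓ ⊔ q)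
  GroupIsProduct A B = ∀ g → ∃[ a ] ∃[ b ] (A a × B b × g ≈ a ∙ b)

  Arc : ∀ {p} → Pred Carrier p → Pred Carrier p → Carrier → Carrier → Set (c ⊔ ℓ ⊔ p)
  Arc L R g h = ∃[ l ] ∃[ r ] (L l × R r × h ≈ (l ⁻¹ ∙ g) ∙ r)

  data Path {p} (L R : Pred Carrier p) : Carrier → Carrier → Set (c ⊔ ℓ ⊔ p) where
    here  : ∀ {g} → Path L R g g
    there : ∀ {g h k} → Arc L R g h → Path L R h k → Path L R g k

  StronglyConnected : ∀ {p} → Pred Carrier p → Pred Carrier p → Set (c ⊔ ℓ ⊔ p)
  StronglyConnected L R = ∀ g h → Path L R g h

  Nonempty : ∀ {p} → Pred Carrier p → Set (c ⊔ p)
  Nonempty S = ∃[ x ] S x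

module Submission where

-- Walking n arcs from g multiplies it by n letters of L⁻¹ on the left and n
-- letters of R on the right, so a path g ⇝ h amounts to h = u⁻¹ g v with u, v
-- words of the SAME length n in L and R ("g and h are n-linked").
--
-- (⇒) Starting from l⁻¹ r every h is linked to e, i.e. h = u⁻¹ v; this gives
--     G = ⟨L⟩⟨R⟩, and for h = r⁻¹ it gives e = u⁻¹ (v r) with lengths n, n+1.
-- (⇐) Write g = u v, h = u′ v′ with u, u′ ∈ ⟨L⟩ = 𝒲(L), v, v′ ∈ ⟨R⟩ = 𝒲(R).
--     For any element z spelled by an L-word X and an R-word Y,
--     h = (u X u′⁻¹)⁻¹ g (v⁻¹ Y v′), so g ⇝ h once both sides have equal
--     length.  The length pairs (|X|, |Y|) form an additive relation on ℕ
--     containing (i, j) (from e = a b, as a⁻¹ = b) and the paddings (k, 0),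
--     (0, k′) (words for e); since |i − j| = 1 such a relation meets every line
--     A + m = B + n, which balances the lengths.

open import Defs
open import Level using (Level; _⊔_)
open import Algebra.Bundles using (Group)
open import Data.Nat using (ℕ; zero; suc; _+_; _*_)
open import Data.Nat.Properties using (+-suc; +-identityʳ)
open import Data.Nat.Tactic.RingSolver using (solve-∀)
open import Data.Product using (∃-syntax; _×_; _,_)
open import Data.Sum using (_⊎_; inj₁; inj₂)
open import Function.Bundles using (_⇔_; mk⇔)
open import Relation.Binary.PropositionalEquality as ≡ using (_≡_)
open import Relation.Unary using (Pred)
import Algebra.Properties.Group as GroupProperties
import Algebra.Solver.Monoid as MonoidSolver
import Relation.Binary.Reasoning.Setoid as SetoidReasoning

record Additive {a} (P : ℕ → ℕ → Set a) : Set a where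
  field
    zero-zero : P 0 0
    plus      : ∀ {m n m′ n′} → P m n → P m′ n′ → P (m + m′) (n + n′)

  scale : ∀ {m n} → P m n → ∀ t → P (t * m) (t * n)
  scale Pmn zero    = zero-zero
  scale Pmn (suc t) = plus Pmn (scale Pmn t)

private
  balance-right : ∀ A B i k →
    A + ((A + B * k) * i + B * suc k) ≡ B + ((A + B * k) * suc i + B * 0)
  balance-right = solve-∀

  balance-left : ∀ A B j k →
    A + ((B + A * k) * suc j + A * 0) ≡ B + ((B + A * k) * j + A * suc k)
  balance-left = solve-∀

-- An additive relation containing a pair (i, j) with |i − j| = 1 and pairs
-- (k + 1, 0), (0, k′ + 1) meets every line A + m = B + n: use t copies of
-- (i, j) to fix the difference and padding pairs to absorb the overshoot.
balance : ∀ {a} {P : ℕ → ℕ → Set a} {i j k k′} → Additive P →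
  P i j → (i ≡ suc j ⊎ j ≡ suc i) → P (suc k) 0 → P 0 (suc k′) →
  ∀ A B → ∃[ m ] ∃[ n ] (P m n × A + m ≡ B + n)
balance {i = i} {k = k} add Pij (inj₂ ≡.refl) padL _ A B =
  t * i + B * suc k , t * suc i + B * 0 ,
  plus (scale Pij t) (scale padL B) , balance-right A B i k
  where open Additive add
        t = A + B * k
balance {j = j} {k′ = k′} add Pij (inj₁ ≡.refl) _ padR A B =
  t * suc j + A * 0 , t * j + A * suc k′ ,
  plus (scale Pij t) (scale padR A) , balance-left A B j k′
  where open Additive add
        t = B + A * k′

-- Regroups the length a + (b + c) of a three-piece word x (z y) as (a + c) + b.
rearrange : ∀ a b c → a + (b + c) ≡ (a + c) + b
rearrange = solve-∀

module _ {c ℓ : Level} (G : Group c ℓ) where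
  open Group G
  open GroupProperties G using (⁻¹-anti-homo-∙; ⁻¹-involutive; inverseʳ-unique)
  open MonoidSolver monoid using (solve; _⊜_; _⊕_; id)
  open SetoidReasoning setoid

  module _ {q} {S : Pred Carrier q} where

    word-resp : ∀ {n x y} → x ≈ y → Word G S n x → Word G S n y
    word-resp x≈y (one Ss e)    = one Ss (trans (sym x≈y) e)
    word-resp x≈y (snoc w Ss e) = snoc w Ss (trans (sym x≈y) e)

    word-cons : ∀ {n s y} → S s → Word G S n y → Word G S (suc n) (s ∙ y)
    word-cons Ss (one St e) = snoc (one Ss refl) St (∙-congˡ e)
    word-cons {s = s} Ss (snoc {y = z} {s = t} w St e) =
      snoc (word-cons Ss w) St (trans (∙-congˡ e) (sym (assoc s z t)))

    _++_ : ∀ {m n x y} → Word G S m x → Word G S n y → Word G S (m + n) (x ∙ y)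
    one Ss e ++ w = word-resp (∙-congʳ (sym e)) (word-cons Ss w)
    _++_ {n = n} {x = xs} {y = y} (snoc {n = m} {y = x} {s = s} u Ss e) w =
      ≡.subst (λ k → Word G S k (xs ∙ y)) (+-suc m n)
        (word-resp (trans (sym (assoc x s y)) (∙-congʳ (sym e))) (u ++ word-cons Ss w))

    word-gen : ∀ {n x} → Word G S n x → Gen G S x
    word-gen (one Ss e)    = resp (sym e) (gen Ss)
    word-gen (snoc w Ss e) = resp (sym e) (mul (word-gen w) (gen Ss))

  gen-least : ∀ {q r} {S : Pred Carrier q} {P : Pred Carrier r} → IsSubgroup G P →
    (∀ {x} → S x → P x) → ∀ {x} → Gen G S x → P x
  gen-least sub S⊆P (gen Sx) = S⊆P Sx
  gen-least (Pε , _) S⊆P unit = Pε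
  gen-least sub@(_ , P∙ , _) S⊆P (mul x y) = P∙ (gen-least sub S⊆P x) (gen-least sub S⊆P y)
  gen-least sub@(_ , _ , P⁻¹ , _) S⊆P (inv x) = P⁻¹ (gen-least sub S⊆P x)
  gen-least sub@(_ , _ , _ , P≈) S⊆P (resp x≈y x) = P≈ x≈y (gen-least sub S⊆P x)

  gen-word : ∀ {q} {S : Pred Carrier q} → IsSubgroup G (𝒲 G S) → ∀ {x} → Gen G S x → 𝒲 G S x
  gen-word sub = gen-least sub (λ Ss → 1 , one Ss refl)

  module _ {q r} {S : Pred Carrier q} {T : Pred Carrier r}
           (inverse-letter : ∀ {s} → S s → ∃[ t ] (T t × s ⁻¹ ≈ t)) where

    word-reverse : ∀ {n x} → Word G S n x → Word G T n (x ⁻¹)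
    word-reverse (one Ss e) =
      let t , Tt , s⁻¹≈t = inverse-letter Ss in one Tt (trans (⁻¹-cong e) s⁻¹≈t)
    word-reverse (snoc {y = y} {s = s} w Ss e) =
      let t , Tt , s⁻¹≈t = inverse-letter Ss in
      word-resp (sym (trans (⁻¹-cong e) (trans (⁻¹-anti-homo-∙ y s) (∙-congʳ s⁻¹≈t))))
        (word-cons Tt (word-reverse w))

  into-InvSet : ∀ {q} {S : Pred Carrier q} {s} → S s → ∃[ t ] (InvSet G S t × s ⁻¹ ≈ t)
  into-InvSet {s = s} Ss = s ⁻¹ , (s , Ss , refl) , refl

  out-of-InvSet : ∀ {q} {S : Pred Carrier q} {s} → InvSet G S s → ∃[ t ] (S t × s ⁻¹ ≈ t)
  out-of-InvSet (l , Sl , s≈l⁻¹) = l , Sl , trans (⁻¹-cong s≈l⁻¹) (⁻¹-involutive l)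

  data Word⁰ {q} (S : Pred Carrier q) : ℕ → Carrier → Set (c ⊔ ℓ ⊔ q) where
    empty : ∀ {x} → x ≈ ε → Word⁰ S 0 x
    word  : ∀ {n x} → Word G S n x → Word⁰ S n x

  module _ {q} {S : Pred Carrier q} where

    _⁰++_ : ∀ {m n x y} → Word⁰ S m x → Word G S n y → Word G S (m + n) (x ∙ y)
    empty x≈ε ⁰++ w = word-resp (sym (trans (∙-congʳ x≈ε) (identityˡ _))) w
    word u    ⁰++ w = u ++ w

    _⁰++⁰_ : ∀ {m n x y} → Word⁰ S m x → Word⁰ S n y → Word⁰ S (m + n) (x ∙ y)
    empty x≈ε ⁰++⁰ empty y≈ε = empty (trans (∙-cong x≈ε y≈ε) (identityˡ ε))
    empty x≈ε ⁰++⁰ word v    = word (empty x≈ε ⁰++ v)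
    _⁰++⁰_ {m = m} (word u) (empty y≈ε) =
      ≡.subst (λ k → Word⁰ S k _) (≡.sym (+-identityʳ m))
        (word (word-resp (sym (trans (∙-congˡ y≈ε) (identityʳ _))) u))
    word u ⁰++⁰ word v = word (u ++ v)

  -- The group identity behind appending one arc to a linked pair.
  extend-≈ : ∀ u l g v r → ((u ∙ l) ⁻¹ ∙ g) ∙ (v ∙ r) ≈ (l ⁻¹ ∙ ((u ⁻¹ ∙ g) ∙ v)) ∙ r
  extend-≈ u l g v r = trans (∙-congʳ (∙-congʳ (⁻¹-anti-homo-∙ u l)))
    (solve 5 (λ l′ u′ g v r → ((l′ ⊕ u′) ⊕ g) ⊕ (v ⊕ r) ⊜ (l′ ⊕ ((u′ ⊕ g) ⊕ v)) ⊕ r)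
      refl (l ⁻¹) (u ⁻¹) g v r)

  -- The group identity behind linking g = u v to h = w⁻¹ z through x ≈ y.
  cancel-through : ∀ {x y} u v w z → x ≈ y →
    ((u ∙ (x ∙ w)) ⁻¹ ∙ (u ∙ v)) ∙ (v ⁻¹ ∙ (y ∙ z)) ≈ w ⁻¹ ∙ z
  cancel-through {x} {y} u v w z x≈y = begin
    ((u ∙ (x ∙ w)) ⁻¹ ∙ (u ∙ v)) ∙ (v ⁻¹ ∙ (y ∙ z))
      ≈⟨ ∙-congʳ (∙-congʳ (trans (⁻¹-anti-homo-∙ u (x ∙ w)) (∙-congʳ (⁻¹-anti-homo-∙ x w)))) ⟩
    (((w ⁻¹ ∙ x ⁻¹) ∙ u ⁻¹) ∙ (u ∙ v)) ∙ (v ⁻¹ ∙ (y ∙ z))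
      ≈⟨ solve 7 (λ w′ x′ u′ u v v′ y →
                    (((w′ ⊕ x′) ⊕ u′) ⊕ (u ⊕ v)) ⊕ (v′ ⊕ y)
                  ⊜ w′ ⊕ ((x′ ⊕ ((u′ ⊕ u) ⊕ (v ⊕ v′))) ⊕ y))
           refl (w ⁻¹) (x ⁻¹) (u ⁻¹) u v (v ⁻¹) (y ∙ z) ⟩
    w ⁻¹ ∙ ((x ⁻¹ ∙ ((u ⁻¹ ∙ u) ∙ (v ∙ v ⁻¹))) ∙ (y ∙ z))
      ≈⟨ ∙-congˡ (∙-congʳ (trans (∙-congˡ units) (identityʳ (x ⁻¹)))) ⟩
    w ⁻¹ ∙ (x ⁻¹ ∙ (y ∙ z))
      ≈⟨ ∙-congˡ (trans (sym (assoc (x ⁻¹) y z)) (trans (∙-congʳ x⁻¹y≈ε) (identityˡ z))) ⟩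
    w ⁻¹ ∙ z ∎
    where
    units : (u ⁻¹ ∙ u) ∙ (v ∙ v ⁻¹) ≈ ε
    units = trans (∙-cong (inverseˡ u) (inverseʳ v)) (identityˡ ε)
    x⁻¹y≈ε : x ⁻¹ ∙ y ≈ ε
    x⁻¹y≈ε = trans (∙-congˡ (sym x≈y)) (inverseˡ x)

  module TwoSided {p} (L R : Pred Carrier p) where

    -- g and h are n-linked if h = u⁻¹ g v for words u in L and v in R of
    -- length n; this is what n consecutive arcs of 2S(G; L, R) do.
    Linked : ℕ → Carrier → Carrier → Set (c ⊔ ℓ ⊔ p)
    Linked n g h = ∃[ u ] ∃[ v ] (Word G L n u × Word G R n v × h ≈ (u ⁻¹ ∙ g) ∙ v)

    linked-arc : ∀ {n g h k} → Linked n g h → Arc G L R h k → Linked (suc n) g k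
    linked-arc {g = g} (u , v , wu , wv , h≈) (l , r , Ll , Rr , k≈) =
      u ∙ l , v ∙ r , snoc wu Ll refl , snoc wv Rr refl ,
      trans k≈ (trans (∙-congʳ (∙-congˡ h≈)) (sym (extend-≈ u l g v r)))

    path-linked : ∀ {n g h k} → Linked n g h → Path G L R h k → ∃[ m ] Linked m g k
    path-linked {n} g~h here        = n , g~h
    path-linked     g~h (there a p) = path-linked (linked-arc g~h a) p

    path-snoc : ∀ {g h k} → Path G L R g h → Arc G L R h k → Path G L R g k
    path-snoc here        a = there a here
    path-snoc (there b p) a = there b (path-snoc p a)

    linked-path : ∀ {n g h} → Linked n g h → Path G L R g h
    linked-path (_ , _ , one {s = l} Ll u≈ , one {s = r} Rr v≈ , h≈) =
      there (l , r , Ll , Rr , trans h≈ (∙-cong (∙-congʳ (⁻¹-cong u≈)) v≈)) here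
    linked-path {g = g} (_ , _ , snoc {y = u} {s = l} wu Ll u≈ , snoc {y = v} {s = r} wv Rr v≈ , h≈) =
      path-snoc (linked-path (u , v , wu , wv , refl))
        (l , r , Ll , Rr , trans h≈ (trans (∙-cong (∙-congʳ (⁻¹-cong u≈)) v≈) (extend-≈ u l g v r)))
    linked-path (_ , _ , one _ _ , snoc () _ _ , _)
    linked-path (_ , _ , snoc () _ _ , one _ _ , _)

    Common : ℕ → ℕ → Set (c ⊔ ℓ ⊔ p)
    Common m n = ∃[ z ] (Word⁰ L m z × Word⁰ R n z)

    common-additive : Additive Common
    common-additive = record { zero-zero = ε , empty refl , empty refl ; plus = plus }
      where
      plus : ∀ {m n m′ n′} → Common m n → Common m′ n′ → Common (m + m′) (n + n′)
      plus (z , X , Y) (z′ , X′ , Y′) = z ∙ z′ , X ⁰++⁰ X′ , Y ⁰++⁰ Y′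

    pad-left : IsSubgroup G (𝒲 G L) → ∃[ k ] Common (suc k) 0
    pad-left ((_ , one Ll e) , _)             = 0 , ε , word (one Ll e) , empty refl
    pad-left ((_ , snoc {n = k} w Ll e) , _) = k , ε , word (snoc w Ll e) , empty refl

    pad-right : IsSubgroup G (𝒲 G R) → ∃[ k ] Common 0 (suc k)
    pad-right ((_ , one Rr e) , _)             = 0 , ε , empty refl , word (one Rr e)
    pad-right ((_ , snoc {n = k} w Rr e) , _) = k , ε , empty refl , word (snoc w Rr e)

    common-path : ∀ {g h u v u′ v′ p₁ p₂ q₁ q₂ m n} →
      g ≈ u ∙ v → h ≈ u′ ∙ v′ →
      Word G L p₁ u → Word G L p₂ (u′ ⁻¹) → Word G R q₁ (v ⁻¹) → Word G R q₂ v′ →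
      Common m n → (p₁ + p₂) + m ≡ (q₁ + q₂) + n → Path G L R g h
    common-path {g} {h} {u} {v} {u′} {v′} {p₁} {p₂} {q₁} {q₂} {m} {n}
                g≈ h≈ wu wu′ wv wv′ (z , X , Y) balanced =
      linked-path (_ , _ , wu ++ (X ⁰++ wu′) , ≡.subst (λ k → Word G R k (v ⁻¹ ∙ (z ∙ v′))) (≡.sym same-length) (wv ++ (Y ⁰++ wv′)) ,
        sym (begin
          ((u ∙ (z ∙ u′ ⁻¹)) ⁻¹ ∙ g) ∙ (v ⁻¹ ∙ (z ∙ v′)) ≈⟨ ∙-congʳ (∙-congˡ g≈) ⟩
          ((u ∙ (z ∙ u′ ⁻¹)) ⁻¹ ∙ (u ∙ v)) ∙ (v ⁻¹ ∙ (z ∙ v′)) ≈⟨ cancel-through u v (u′ ⁻¹) v′ refl ⟩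
          u′ ⁻¹ ⁻¹ ∙ v′ ≈⟨ ∙-congʳ (⁻¹-involutive u′) ⟩
          u′ ∙ v′ ≈⟨ sym h≈ ⟩
          h ∎))
      where
      same-length : p₁ + (m + p₂) ≡ q₁ + (n + q₂)
      same-length = ≡.trans (rearrange p₁ m p₂) (≡.trans balanced (≡.sym (rearrange q₁ n q₂)))

    UnbalancedIdentity : Set (c ⊔ ℓ ⊔ p)
    UnbalancedIdentity = ∃[ i ] ∃[ j ] ∃[ a ] ∃[ b ]
      (Word G (InvSet G L) i a × Word G R j b × ε ≈ a ∙ b × (i ≡ suc j ⊎ j ≡ suc i))

    -- Such a factorisation is a common pair: a⁻¹ = b is spelled in L and in R.
    unbalanced-common : ∀ {i j a b} →
      Word G (InvSet G L) i a → Word G R j b → ε ≈ a ∙ b → Common i j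
    unbalanced-common {a = a} {b} wa wb ε≈ab =
      b , word (word-resp (sym (inverseʳ-unique a b (sym ε≈ab))) (word-reverse out-of-InvSet wa)) , word wb

    necessity : Nonempty G L → Nonempty G R → StronglyConnected G L R →
      GroupIsProduct G (Gen G L) (Gen G R) × UnbalancedIdentity
    necessity (l , Ll) (r , Rr) sc = product , unbalanced (linked-from-ε (r ⁻¹))
      where
      -- every element is linked to ε, starting from the vertex l⁻¹ r
      linked-from-ε : ∀ h → ∃[ n ] Linked n ε h
      linked-from-ε h = path-linked (l , r , one Ll refl , one Rr refl , refl) (sc _ h)

      product : GroupIsProduct G (Gen G L) (Gen G R)
      product h = let _ , u , v , wu , wv , h≈ = linked-from-ε h in
        u ⁻¹ , v , inv (word-gen wu) , word-gen wv , trans h≈ (∙-congʳ (identityʳ (u ⁻¹)))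

      unbalanced : ∃[ n ] Linked n ε (r ⁻¹) → UnbalancedIdentity
      unbalanced (n , u , v , wu , wv , r⁻¹≈) =
        n , suc n , u ⁻¹ , v ∙ r , word-reverse into-InvSet wu , snoc wv Rr refl ,
        (begin
          ε ≈⟨ sym (inverseˡ r) ⟩
          r ⁻¹ ∙ r ≈⟨ ∙-congʳ r⁻¹≈ ⟩
          ((u ⁻¹ ∙ ε) ∙ v) ∙ r ≈⟨ solve 3 (λ u′ v r → ((u′ ⊕ id) ⊕ v) ⊕ r ⊜ u′ ⊕ (v ⊕ r)) refl (u ⁻¹) v r ⟩
          u ⁻¹ ∙ (v ∙ r) ∎) ,
        inj₂ ≡.refl

    sufficiency : IsSubgroup G (𝒲 G L) → IsSubgroup G (𝒲 G R) →
      GroupIsProduct G (Gen G L) (Gen G R) × UnbalancedIdentity → StronglyConnected G L R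
    sufficiency subL subR (product , i , j , a , b , wa , wb , ε≈ab , i~j) g h =
      let u , v , u∈ , v∈ , g≈ = product g
          u′ , v′ , u′∈ , v′∈ , h≈ = product h
          p₁ , wu = gen-word subL u∈
          p₂ , wu′ = gen-word subL (inv u′∈)
          q₁ , wv = gen-word subR (inv v∈)
          q₂ , wv′ = gen-word subR v′∈
          _ , padL = pad-left subL
          _ , padR = pad-right subR
          m , n , common , balanced =
            balance common-additive (unbalanced-common wa wb ε≈ab) i~j padL padR (p₁ + p₂) (q₁ + q₂)
      in common-path g≈ h≈ wu wu′ wv wv′ common balanced

corollary3p12 : ∀ {c ℓ p : Level} (G : Group c ℓ) (L R : Pred (Group.Carrier G) p) →
    Nonempty G L → Nonempty G R →
    IsSubgroup G (𝒲 G L) → IsSubgroup G (𝒲 G R) →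
    StronglyConnected G L R ⇔
      (GroupIsProduct G (Gen G L) (Gen G R) ×
        ∃[ i ] ∃[ j ] ∃[ a ] ∃[ b ]
          (Word G (InvSet G L) i a × Word G R j b ×
           Group._≈_ G (Group.ε G) (Group._∙_ G a b) ×
           (i ≡ suc j ⊎ j ≡ suc i)))
corollary3p12 G L R L≠∅ R≠∅ subL subR =
  mk⇔ (necessity L≠∅ R≠∅) (sufficiency subL subR)
  where open TwoSided G L R
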